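{- Let $n\ge 3$. Every smooth arithmetical structure $(\mathbf d,\mathbf r)$ on $D_n$ satisfies $d_0=1$.
   Context: For $n\ge 3$ let $\ell=n-3$. The bident $D_n$ has vertices $v_x,v_y,v_0,\dots,v_\ell$ and edges $v_xv_0$, $v_yv_0$, $v_iv_{i+1}$ ($0\le i\le\ell-1$). An arithmetical structure on $D_n$ is a pair $(\mathbf d,\mathbf r)$, $\mathbf d=(d_x,d_y,d_0,\dots,d_\ell)$, $\mathbf r=(r_x,r_y,r_0,\dots,r_\ell)$, of positive integer vectors with $(\operatorname{diag}(\mathbf d)-A)\mathbf r=\mathbf 0$ ($A$ the adjacency matrix) and the entries of $\mathbf r$ having no nontrivial common factor. It is smooth if $d_x,d_y,d_1,\dots,d_\ell\ge2$. -}

module Defs where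

open import Data.Nat using (ℕ; zero; suc; _+_; _*_; _≤_)
open import Data.Nat.Divisibility using (_∣_)
open import Data.Fin using (Fin; zero; suc; toℕ)
open import Data.Bool using (Bool; true; false)
open import Data.Vec.Functional using (Vector)
open import Data.Fin using () renaming (zero to fz)
open import Relation.Binary.PropositionalEquality using (_≡_)
open import Relation.Nullary using (¬_)

-- Vertices of the bident D_n, n = ℓ + 3, are indexed by Fin (ℓ + 3):
--   index 0       ↦ v_x
--   index 1       ↦ v_y
--   index (2 + i) ↦ v_i   (0 ≤ i ≤ ℓ)

-- Edge relation on indices (symmetric): v_x v_0, v_y v_0, v_i v_{i+1}.
-- In indices: {0,2}, {1,2}, {2+i, 3+i}.
bidentEdgeℕ : ℕ → ℕ → Bool
bidentEdgeℕ 0 2 = true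
bidentEdgeℕ 2 0 = true
bidentEdgeℕ 1 2 = true
bidentEdgeℕ 2 1 = true
bidentEdgeℕ (suc (suc a)) (suc (suc b)) = chain a b
  where
  chain : ℕ → ℕ → Bool
  chain zero (suc zero) = true
  chain (suc zero) zero = true
  chain (suc a) (suc b) = chain a b
  chain _ _ = false
bidentEdgeℕ _ _ = false

bidentAdj : (ℓ : ℕ) → Fin (3 + ℓ) → Fin (3 + ℓ) → ℕ
bidentAdj ℓ v w with bidentEdgeℕ (toℕ v) (toℕ w)
... | true = 1
... | false = 0

∑ : (m : ℕ) → (Fin m → ℕ) → ℕ
∑ zero f = 0
∑ (suc m) f = f fz + ∑ m (λ i → f (suc i))

-- Arithmetical structure (d, r) on D_n, n = ℓ + 3:
-- d, r positive, (diag d − A) r = 0 (written entrywise over ℕ as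
-- d_v r_v = Σ_w A_vw r_w), and the entries of r have no common factor > 1.
record IsArithmeticalStructure (ℓ : ℕ) (d r : Vector ℕ (3 + ℓ)) : Set where
  field
    d-pos : ∀ v → 1 ≤ d v
    r-pos : ∀ v → 1 ≤ r v
    balance : ∀ v → d v * r v ≡ ∑ (3 + ℓ) (λ w → bidentAdj ℓ v w * r w)
    no-common-factor : ∀ k → (∀ v → k ∣ r v) → k ≡ 1

IsSmooth : (ℓ : ℕ) → Vector ℕ (3 + ℓ) → Set
IsSmooth ℓ d = ∀ v → ¬ (toℕ v ≡ 2) → 2 ≤ d v

v₀ : (ℓ : ℕ) → Fin (3 + ℓ)
v₀ ℓ = suc (suc fz)

-- Writing r for the multiplicity vector, smoothness at a leaf gives 2 r_x ≤ d_x r_x = r_0 and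
-- likewise 2 r_y ≤ r_0, so r_x + r_y ≤ r_0.  Along the path v_0, …, v_ℓ the inequalities
-- 2 r_{i+1} ≤ d_{i+1} r_{i+1} = r_i + r_{i+2} make r convex, and its last step
-- r_ℓ > 0 = r_{ℓ+1} is a descent, so every step descends; in particular r_1 < r_0.
-- Hence d_0 r_0 = r_x + r_y + r_1 < 2 r_0, which forces d_0 = 1.
module Submission where

open import Defs
open import Data.Bool using (true; false; if_then_else_)
open import Data.Fin using (Fin; toℕ) renaming (zero to fz; suc to fs)
open import Data.Fin.Properties using (toℕ<n)
open import Data.Nat using (ℕ; zero; suc; _+_; _*_; _≤_; _<_; z≤n; s≤s; s≤s⁻¹)
open import Data.Nat.Properties
open import Data.Vec.Functional using (Vector)
open import Function using (_∘_)
open import Relation.Binary.PropositionalEquality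
  using (_≡_; _≢_; refl; sym; trans; cong; cong₂; module ≡-Reasoning)

convex-step : ∀ {a b c} → 2 * a ≤ b + c → c < a → a < b
convex-step {a} {b} {c} 2a≤b+c c<a = +-cancelʳ-< a a b (begin-strict
  a + a  ≡⟨ cong (a +_) (sym (+-identityʳ a)) ⟩
  2 * a  ≤⟨ 2a≤b+c ⟩
  b + c  <⟨ +-monoʳ-< b c<a ⟩
  b + a  ∎)
  where open ≤-Reasoning

convex⇒x₁<x₀ : ∀ n (x : ℕ → ℕ) →
               ((j : Fin n) → 2 * x (suc (toℕ j)) ≤ x (toℕ j) + x (2 + toℕ j)) →
               x (suc n) < x n → x 1 < x 0
convex⇒x₁<x₀ zero    x convex last = last
convex⇒x₁<x₀ (suc n) x convex last =
  convex-step (convex fz) (convex⇒x₁<x₀ n (x ∘ suc) (convex ∘ fs) last)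

2*≤⇒+≤ : ∀ {a b c} → 2 * a ≤ c → 2 * b ≤ c → a + b ≤ c
2*≤⇒+≤ {a} {b} {c} 2a≤c 2b≤c = *-cancelˡ-≤ 2 (begin
  2 * (a + b)    ≡⟨ *-distribˡ-+ 2 a b ⟩
  2 * a + 2 * b  ≤⟨ +-mono-≤ 2a≤c 2b≤c ⟩
  c + c          ≡⟨ cong (c +_) (sym (+-identityʳ c)) ⟩
  2 * c          ∎)
  where open ≤-Reasoning

∑-cong : ∀ m {f g : Fin m → ℕ} → (∀ w → f w ≡ g w) → ∑ m f ≡ ∑ m g
∑-cong zero     f≗g = refl
∑-cong (suc m) f≗g = cong₂ _+_ (f≗g fz) (∑-cong m (f≗g ∘ fs))

∑-zero : ∀ m → ∑ m (λ _ → 0) ≡ 0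
∑-zero zero    = refl
∑-zero (suc m) = ∑-zero m

extendByZero : ∀ {m} → Vector ℕ m → ℕ → ℕ
extendByZero {zero}  r k       = 0
extendByZero {suc m} r zero    = r fz
extendByZero {suc m} r (suc k) = extendByZero (r ∘ fs) k

extendByZero-toℕ : ∀ {m} (r : Vector ℕ m) w → extendByZero r (toℕ w) ≡ r w
extendByZero-toℕ r fz     = refl
extendByZero-toℕ r (fs w) = extendByZero-toℕ (r ∘ fs) w

extendByZero-length : ∀ m (r : Vector ℕ m) → extendByZero r m ≡ 0
extendByZero-length zero    r = refl
extendByZero-length (suc m) r = extendByZero-length m (r ∘ fs)

extendByZero-pos : ∀ {m} {r : Vector ℕ m} → (∀ w → 1 ≤ r w) → ∀ {k} → k < m → 1 ≤ extendByZero r k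
extendByZero-pos {suc m} r-pos {zero}  _         = r-pos fz
extendByZero-pos {suc m} r-pos {suc k} (s≤s k<m) = extendByZero-pos (r-pos ∘ fs) k<m

neighbourSum : ℕ → ℕ → (ℕ → ℕ) → ℕ
neighbourSum m k x = ∑ m (λ w → if bidentEdgeℕ k (toℕ w) then x (toℕ w) else 0)

neighbourSum-shift : ∀ a m x → neighbourSum (suc m) (4 + a) x ≡ neighbourSum m (3 + a) (x ∘ suc)
neighbourSum-shift a m x = ∑-cong m (λ w → cong (λ b → if b then x (suc (toℕ w)) else 0) (shift (toℕ w)))
  where
  shift : ∀ j → bidentEdgeℕ (4 + a) (suc j) ≡ bidentEdgeℕ (3 + a) j
  shift zero          = refl
  shift (suc zero)    = refl
  shift (suc (suc j)) = refl

+-∑-zero : ∀ a n → a + ∑ n (λ _ → 0) ≡ a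
+-∑-zero a n = trans (cong (a +_) (∑-zero n)) (+-identityʳ a)

neighbourSum-leaf : ∀ {k} → k ≤ 1 → ∀ n x → neighbourSum (3 + n) k x ≡ x 2
neighbourSum-leaf z≤n       n x = +-∑-zero (x 2) n
neighbourSum-leaf (s≤s z≤n) n x = +-∑-zero (x 2) n

neighbourSum-hub : ∀ n x → neighbourSum (3 + n) 2 x ≤ x 0 + x 1 + x 3
neighbourSum-hub zero    x = begin
  x 0 + (x 1 + 0)  ≡⟨ sym (+-assoc (x 0) (x 1) 0) ⟩
  x 0 + x 1 + 0    ≤⟨ +-monoʳ-≤ (x 0 + x 1) z≤n ⟩
  x 0 + x 1 + x 3  ∎
  where open ≤-Reasoning
neighbourSum-hub (suc n) x = ≤-reflexive (begin
  x 0 + (x 1 + (x 3 + ∑ n (λ _ → 0)))  ≡⟨ cong (λ t → x 0 + (x 1 + t)) (+-∑-zero (x 3) n) ⟩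
  x 0 + (x 1 + x 3)                     ≡⟨ sym (+-assoc (x 0) (x 1) (x 3)) ⟩
  x 0 + x 1 + x 3                       ∎)
  where open ≡-Reasoning

neighbourSum-path : ∀ {a m} x → 4 + a ≤ m → neighbourSum m (3 + a) x ≤ x (2 + a) + x (4 + a)
neighbourSum-path {zero} x (s≤s (s≤s (s≤s (s≤s {n = zero} _))))  = +-monoʳ-≤ (x 2) z≤n
neighbourSum-path {zero} x (s≤s (s≤s (s≤s (s≤s {n = suc n} _)))) =
  ≤-reflexive (cong (x 2 +_) (+-∑-zero (x 4) n))
neighbourSum-path {suc a} {suc m} x (s≤s 4+a≤m) = begin
  neighbourSum (suc m) (4 + a) x    ≡⟨ neighbourSum-shift a m x ⟩
  neighbourSum m (3 + a) (x ∘ suc)  ≤⟨ neighbourSum-path (x ∘ suc) 4+a≤m ⟩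
  x (3 + a) + x (5 + a)             ∎
  where open ≤-Reasoning

bidentAdj-* : ∀ ℓ v w y → bidentAdj ℓ v w * y ≡ (if bidentEdgeℕ (toℕ v) (toℕ w) then y else 0)
bidentAdj-* ℓ v w y with bidentEdgeℕ (toℕ v) (toℕ w)
... | true  = +-identityʳ y
... | false = refl

module SmoothStructure {ℓ : ℕ} {d r : Vector ℕ (3 + ℓ)}
                       (A : IsArithmeticalStructure ℓ d r) (S : IsSmooth ℓ d) where
  open IsArithmeticalStructure A

  -- R (2 + i) = r_{v_i}, and the padding R (3 + ℓ) = 0 plays the role of r_{v_{ℓ+1}}.
  R : ℕ → ℕ
  R = extendByZero r

  balanceᴿ : ∀ v → d v * R (toℕ v) ≡ neighbourSum (3 + ℓ) (toℕ v) R
  balanceᴿ v = begin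
    d v * R (toℕ v)                             ≡⟨ cong (d v *_) (extendByZero-toℕ r v) ⟩
    d v * r v                                   ≡⟨ balance v ⟩
    ∑ (3 + ℓ) (λ w → bidentAdj ℓ v w * r w)     ≡⟨ ∑-cong (3 + ℓ) adj*r≡ ⟩
    neighbourSum (3 + ℓ) (toℕ v) R              ∎
    where
    open ≡-Reasoning
    adj*r≡ : ∀ w → bidentAdj ℓ v w * r w ≡ (if bidentEdgeℕ (toℕ v) (toℕ w) then R (toℕ w) else 0)
    adj*r≡ w = trans (bidentAdj-* ℓ v w (r w))
                     (cong (λ y → if bidentEdgeℕ (toℕ v) (toℕ w) then y else 0) (sym (extendByZero-toℕ r w)))

  2R≤neighbourSum : ∀ v → toℕ v ≢ 2 → 2 * R (toℕ v) ≤ neighbourSum (3 + ℓ) (toℕ v) R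
  2R≤neighbourSum v v≢v₀ = ≤-trans (*-monoˡ-≤ (R (toℕ v)) (S v v≢v₀)) (≤-reflexive (balanceᴿ v))

  leaves : R 0 + R 1 ≤ R 2
  leaves = 2*≤⇒+≤ {R 0} {R 1} (leaf fz z≤n) (leaf (fs fz) (s≤s z≤n))
    where
    leaf : ∀ v → toℕ v ≤ 1 → 2 * R (toℕ v) ≤ R 2
    leaf v v≤1 = ≤-trans (2R≤neighbourSum v (λ v≡2 → <-irrefl v≡2 (s≤s v≤1)))
                         (≤-reflexive (neighbourSum-leaf v≤1 ℓ R))

  hub : d (v₀ ℓ) * R 2 ≤ R 0 + R 1 + R 3
  hub = ≤-trans (≤-reflexive (balanceᴿ (v₀ ℓ))) (neighbourSum-hub ℓ R)

  path-convex : (j : Fin ℓ) → 2 * R (3 + toℕ j) ≤ R (2 + toℕ j) + R (4 + toℕ j)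
  path-convex j = ≤-trans (2R≤neighbourSum (fs (fs (fs j))) (λ ()))
                          (neighbourSum-path R (s≤s (s≤s (s≤s (toℕ<n j)))))

  path-end : R (3 + ℓ) < R (2 + ℓ)
  path-end rewrite extendByZero-length (3 + ℓ) r = extendByZero-pos r-pos ≤-refl

proposition2p3 : (ℓ : ℕ) (d r : Vector ℕ (3 + ℓ)) →
    IsArithmeticalStructure ℓ d r → IsSmooth ℓ d → d (v₀ ℓ) ≡ 1
proposition2p3 ℓ d r A S = ≤-antisym (s≤s⁻¹ (*-cancelʳ-< (R 2) (d (v₀ ℓ)) 2 d₀R₂<2R₂)) (d-pos (v₀ ℓ))
  where
  open IsArithmeticalStructure A
  open SmoothStructure A S
  open ≤-Reasoning

  R₃<R₂ : R 3 < R 2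
  R₃<R₂ = convex⇒x₁<x₀ ℓ (R ∘ (2 +_)) path-convex path-end

  d₀R₂<2R₂ : d (v₀ ℓ) * R 2 < 2 * R 2
  d₀R₂<2R₂ = begin-strict
    d (v₀ ℓ) * R 2   ≤⟨ hub ⟩
    R 0 + R 1 + R 3  <⟨ +-mono-≤-< leaves R₃<R₂ ⟩
    R 2 + R 2        ≡⟨ cong (R 2 +_) (sym (+-identityʳ (R 2))) ⟩
    2 * R 2          ∎
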